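{- Let $H:\mathbf{Set}\to\mathbf{Set}$ be a functor having a lifting to a locally continuous endofunctor $H'$ of $\mathbf{CPO}$. Then every $\mathbf{CPO}$-enrichable $H$-algebra $\alpha:HA\to A$ is a complete Elgot algebra (in $\mathbf{Set}$).
   Context: $\mathbf{CPO}$ is the category of $\omega$-complete posets and continuous maps; $H':\mathbf{CPO}\to\mathbf{CPO}$ is locally continuous if it preserves joins of increasing $\omega$-chains of morphisms $X\to Y$ (pointwise order); it is a lifting of $H$ if $UH'=HU$ for the forgetful $U:\mathbf{CPO}\to\mathbf{Set}$. An $H$-algebra $\alpha:HA\to A$ is $\mathbf{CPO}$-enrichable if there is an $\omega$-complete partial order $\sqsubseteq$ with a least element on $A$ such that $\alpha$ is continuous from $H'(A,\sqsubseteq)$ to $(A,\sqsubseteq)$. A flat equation morphism in $A$ is a map $e:X\to HX+A$; a solution is $e^\dagger:X\to A$ with $e^\dagger=[\alpha,\mathrm{id}_A]\cdot(He^\dagger+\mathrm{id}_A)\cdot e$. For $e:X\to HX+Y$ and $h:Y\to Z$, $h\bullet e:=(\mathrm{id}_{HX}+h)\cdot e$; for $e:X\to HX+Y$, $f:Y\to HY+A$, $f\oplus e:=(\mathrm{can}+\mathrm{id}_A)\cdot(\mathrm{id}_{HX}+f)\cdot[e,\mathrm{inr}]$ with $\mathrm{can}=[H\mathrm{inl},H\mathrm{inr}]$. A complete Elgot algebra is an $H$-algebra with an assignment $e\mapsto e^\dagger$ of a solution to every flat equation morphism that is functorial ($e^\dagger=f^\dagger\cdot h$ whenever $(Hh+\mathrm{id}_A)\cdot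 e=f\cdot h$) and compositional ($(f^\dagger\bullet e)^\dagger=(f\oplus e)^\dagger\cdot\mathrm{inl}$). -}

module Defs where

open import Data.Nat using (ℕ; suc)
open import Data.Sum using (_⊎_; inj₁; inj₂; [_,_])
open import Data.Sum renaming (map to _⊎map_)
open import Data.Product using (Σ; _×_; _,_)
open import Function using (_∘_; id)
open import Relation.Binary.PropositionalEquality using (_≡_)

-- An endofunctor of Set (Set = Agda's Set₀). Equality of functions is
-- pointwise (extensional), as in the category Set.
record Functor : Set₁ where
  field
    F₀      : Set → Set
    fmap    : ∀ {X Y : Set} → (X → Y) → F₀ X → F₀ Y
    fmap-id : ∀ {X : Set} (z : F₀ X) → fmap (id {A = X}) z ≡ z
    fmap-∘  : ∀ {X Y Z : Set} (g : Y → Z) (f : X → Y) (z : F₀ X) →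
              fmap (g ∘ f) z ≡ fmap g (fmap f z)
    fmap-cong : ∀ {X Y : Set} {f g : X → Y} → (∀ x → f x ≡ g x) →
                ∀ z → fmap f z ≡ fmap g z

-- An ω-complete partial order structure on a set A
-- (joins of increasing ω-chains; no least element required).
record ωCPO (A : Set) : Set₁ where
  field
    _⊑_     : A → A → Set
    ⊑-refl  : ∀ {a} → a ⊑ a
    ⊑-trans : ∀ {a b c} → a ⊑ b → b ⊑ c → a ⊑ c
    ⊑-antisym : ∀ {a b} → a ⊑ b → b ⊑ a → a ≡ b
    ⨆       : (c : ℕ → A) → (∀ n → c n ⊑ c (suc n)) → A
    ⨆-ub    : ∀ c p n → c n ⊑ ⨆ c p
    ⨆-least : ∀ c p b → (∀ n → c n ⊑ b) → ⨆ c p ⊑ b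

open ωCPO public

record Continuous {A B : Set} (P : ωCPO A) (Q : ωCPO B) (f : A → B) : Set where
  field
    mono : ∀ {a b} → _⊑_ P a b → _⊑_ Q (f a) (f b)
    pres : ∀ c p → f (⨆ P c p) ≡ ⨆ Q (f ∘ c) (λ n → mono (p n))

-- A lifting H' of H to CPO (U H' = H U): on objects it puts a cpo
-- structure on H X; on morphisms it acts as H (i.e. fmap), which must be
-- continuous. Functor laws of H' are inherited from those of H.
record Lifting (H : Functor) : Set₁ where
  open Functor H
  field
    lift     : ∀ {X : Set} → ωCPO X → ωCPO (F₀ X)
    lift-mor : ∀ {X Y : Set} (P : ωCPO X) (Q : ωCPO Y) (f : X → Y) →
               Continuous P Q f → Continuous (lift P) (lift Q) (fmap f)

-- Local continuity: for an increasing ω-chain (f n) of continuous maps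
-- X → Y (pointwise order), H'(⨆ f n) = ⨆ H'(f n), i.e. H(⨆ f n) is the
-- least upper bound (pointwise in H' Y) of the H (f n).
LocallyContinuous : (H : Functor) → Lifting H → Set₁
LocallyContinuous H L =
  ∀ {X Y : Set} (P : ωCPO X) (Q : ωCPO Y) (fs : ℕ → X → Y)
    (cont : ∀ n → Continuous P Q (fs n))
    (inc : ∀ n x → _⊑_ Q (fs n x) (fs (suc n) x)) →
    let g  : X → Y
        g x = ⨆ Q (λ n → fs n x) (λ n → inc n x)
    in (∀ z n → _⊑_ (lift (Q)) (fmap (fs n) z) (fmap g z))
     × (∀ z b → (∀ n → _⊑_ (lift Q) (fmap (fs n) z) b) → _⊑_ (lift Q) (fmap g z) b)
  where open Functor H
        open Lifting L

CPOEnrichable : (H : Functor) → Lifting H → (A : Set) → (Functor.F₀ H A → A) → Set₁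
CPOEnrichable H L A α =
  Σ (ωCPO A) λ P → Σ A λ ⊥ → (∀ a → _⊑_ P ⊥ a) × Continuous (Lifting.lift L P) P α

_•_ : ∀ {H : Functor} {X Y Z : Set} → (Y → Z) →
      (X → Functor.F₀ H X ⊎ Y) → X → Functor.F₀ H X ⊎ Z
(h • e) x = (id ⊎map h) (e x)

⊕ : (H : Functor) {X Y A : Set} → (Y → Functor.F₀ H Y ⊎ A) →
    (X → Functor.F₀ H X ⊎ Y) → (X ⊎ Y) → Functor.F₀ H (X ⊎ Y) ⊎ A
⊕ H {X} {Y} {A} f e = (can ⊎map id) ∘ assoc ∘ (id ⊎map f) ∘ [ e , inj₂ ]
  where open Functor H
        can : F₀ X ⊎ F₀ Y → F₀ (X ⊎ Y)
        can = [ fmap inj₁ , fmap inj₂ ]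
        -- the canonical iso HX + (HY + A) ≅ (HX + HY) + A left implicit in the paper
        assoc : F₀ X ⊎ (F₀ Y ⊎ A) → (F₀ X ⊎ F₀ Y) ⊎ A
        assoc = [ inj₁ ∘ inj₁ , [ inj₁ ∘ inj₂ , inj₂ ] ]

record CompleteElgot (H : Functor) (A : Set) (α : Functor.F₀ H A → A) : Set₁ where
  open Functor H
  field
    _†       : ∀ {X : Set} → (X → F₀ X ⊎ A) → X → A
    solution : ∀ {X : Set} (e : X → F₀ X ⊎ A) (x : X) →
               (e †) x ≡ [ α , id ] ((fmap (e †) ⊎map id) (e x))
    functorial : ∀ {X Y : Set} (e : X → F₀ X ⊎ A) (f : Y → F₀ Y ⊎ A) (h : X → Y) →
                 (∀ x → (fmap h ⊎map id) (e x) ≡ f (h x)) →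
                 ∀ x → (e †) x ≡ (f †) (h x)
    compositional : ∀ {X Y : Set} (e : X → F₀ X ⊎ Y) (f : Y → F₀ Y ⊎ A) →
                    ∀ x → ((_•_ {H} (f †) e) †) x ≡ (⊕ H f e †) (inj₁ x)

{-# OPTIONS --safe #-}
-- The solution of a flat equation e : X → HX + A is the least fixed point of
-- s ↦ [α, id] ∘ (Hs + id) ∘ e in the pointwise order on A^X. Local continuity
-- of H' (applied to the discrete cpo on X) together with continuity of α makes
-- this operator continuous, so Kleene's construction ⨆ₙ Φⁿ(⊥) yields a
-- solution. Functoriality holds already for each approximant Φⁿ(⊥), and
-- compositionality follows by showing that each side of the equation is a
-- fixed point of the operator whose least fixed point is the other side.
module Submission where

open import Defs
open import Data.Nat using (ℕ; zero; suc)
open import Data.Sum using (_⊎_; inj₁; inj₂; [_,_])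
open import Data.Sum renaming (map to _⊎map_)
open import Data.Product using (_,_; proj₁; proj₂)
open import Function using (_∘_; id)
open import Relation.Binary.PropositionalEquality
  using (_≡_; refl; sym; trans; cong; subst; module ≡-Reasoning)

module _ {A : Set} (P : ωCPO A) where

  Increasing : (ℕ → A) → Set
  Increasing c = ∀ n → _⊑_ P (c n) (c (suc n))

  ⊑-reflexive : ∀ {a b} → a ≡ b → _⊑_ P a b
  ⊑-reflexive refl = ⊑-refl P

  ⨆-cong : ∀ c d (p : Increasing c) (q : Increasing d) →
           (∀ n → c n ≡ d n) → ⨆ P c p ≡ ⨆ P d q
  ⨆-cong c d p q c≡d = ⊑-antisym P
    (⨆-least P c p _ (λ n → ⊑-trans P (⊑-reflexive (c≡d n)) (⨆-ub P d q n)))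
    (⨆-least P d q _ (λ n → ⊑-trans P (⊑-reflexive (sym (c≡d n))) (⨆-ub P c p n)))

  ⨆-const : ∀ a (p : Increasing (λ _ → a)) → ⨆ P (λ _ → a) p ≡ a
  ⨆-const a p = ⊑-antisym P (⨆-least P _ p a (λ _ → ⊑-refl P)) (⨆-ub P _ p 0)

  ⨆-suc : ∀ c (p : Increasing (c ∘ suc)) (q : Increasing c) → ⨆ P (c ∘ suc) p ≡ ⨆ P c q
  ⨆-suc c p q = ⊑-antisym P
    (⨆-least P _ p _ (λ n → ⨆-ub P c q (suc n)))
    (⨆-least P c q _ (λ n → ⊑-trans P (q n) (⨆-ub P _ p n)))

  _≤̇_ : {X : Set} → (X → A) → (X → A) → Set
  s ≤̇ t = ∀ x → _⊑_ P (s x) (t x)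

  ⨆̇ : {X : Set} (fs : ℕ → X → A) → (∀ n → fs n ≤̇ fs (suc n)) → X → A
  ⨆̇ fs inc x = ⨆ P (λ n → fs n x) (λ n → inc n x)

discrete : (X : Set) → ωCPO X
discrete X = record
  { _⊑_ = _≡_ ; ⊑-refl = refl ; ⊑-trans = trans ; ⊑-antisym = λ p _ → p
  ; ⨆ = λ c _ → c 0 ; ⨆-ub = constant ; ⨆-least = λ c _ _ c≡b → c≡b 0 }
  where
  constant : (c : ℕ → X) (p : ∀ n → c n ≡ c (suc n)) (n : ℕ) → c n ≡ c 0
  constant c p zero    = refl
  constant c p (suc n) = trans (sym (p n)) (constant c p n)

discrete-continuous : ∀ {X B} (Q : ωCPO B) (f : X → B) → Continuous (discrete X) Q f
discrete-continuous {X} Q f = record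
  { mono = λ a≡b → ⊑-reflexive Q (cong f a≡b)
  ; pres = λ c p → ⊑-antisym Q
      (⨆-ub Q (f ∘ c) _ 0)
      (⨆-least Q _ _ _ (λ n → ⊑-reflexive Q (cong f (⨆-ub (discrete X) c p n)))) }

-- Kleene's fixed point theorem for operators on A^X, ordered pointwise; A^X is
-- not itself an ωCPO here since that would need function extensionality.
module Kleene {A : Set} (P : ωCPO A) (⊥ : A) (⊥-least : ∀ a → _⊑_ P ⊥ a) where

  record ContinuousOperator (X : Set) : Set where
    field
      apply : (X → A) → X → A
      mono  : ∀ {s t} → _≤̇_ P s t → _≤̇_ P (apply s) (apply t)
      pres  : ∀ fs inc x → apply (⨆̇ P fs inc) x ≡
                           ⨆ P (λ n → apply (fs n) x) (λ n → mono (inc n) x)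

  open ContinuousOperator

  module _ {X : Set} (Φ : ContinuousOperator X) where

    iterate : ℕ → X → A
    iterate zero    _ = ⊥
    iterate (suc n) = apply Φ (iterate n)

    iterate-increasing : ∀ n → _≤̇_ P (iterate n) (iterate (suc n))
    iterate-increasing zero    _ = ⊥-least _
    iterate-increasing (suc n)   = mono Φ (iterate-increasing n)

    lfp : X → A
    lfp = ⨆̇ P iterate iterate-increasing

    lfp-fixed : ∀ x → lfp x ≡ apply Φ lfp x
    lfp-fixed x = begin
      lfp x                                   ≡⟨ sym (⨆-suc P (λ n → iterate n x) _ _) ⟩
      ⨆ P (λ n → iterate (suc n) x) _         ≡⟨ sym (pres Φ iterate iterate-increasing x) ⟩
      apply Φ lfp x                           ∎
      where open ≡-Reasoning

    lfp-least : ∀ t → _≤̇_ P (apply Φ t) t → _≤̇_ P lfp t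
    lfp-least t Φt≤t x = ⨆-least P _ _ _ (λ n → iterate≤t n x)
      where
      iterate≤t : ∀ n → _≤̇_ P (iterate n) t
      iterate≤t zero    _ = ⊥-least _
      iterate≤t (suc n) y = ⊑-trans P (mono Φ (iterate≤t n) y) (Φt≤t y)

  lfp-natural : ∀ {X Y} (Φ : ContinuousOperator X) (Ψ : ContinuousOperator Y) (h : X → Y) →
                (∀ s t → (∀ x → s x ≡ t (h x)) → ∀ x → apply Φ s x ≡ apply Ψ t (h x)) →
                ∀ x → lfp Φ x ≡ lfp Ψ (h x)
  lfp-natural Φ Ψ h natural x = ⨆-cong P _ _ _ _ (λ n → iterate-natural n x)
    where
    iterate-natural : ∀ n x → iterate Φ n x ≡ iterate Ψ n (h x)
    iterate-natural zero    _ = refl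
    iterate-natural (suc n)   = natural _ _ (iterate-natural n)

module _ (H : Functor) (L : Lifting H) (lc : LocallyContinuous H L)
         {A : Set} (α : Functor.F₀ H A → A) (P : ωCPO A) where
  open Functor H
  open Lifting L

  fmap-⨆-upper : ∀ {X} (fs : ℕ → X → A) (inc : ∀ n → _≤̇_ P (fs n) (fs (suc n))) z n →
                 _⊑_ (lift P) (fmap (fs n) z) (fmap (⨆̇ P fs inc) z)
  fmap-⨆-upper {X} fs inc = proj₁ (lc (discrete X) P fs (λ n → discrete-continuous P (fs n)) inc)

  fmap-⨆-least : ∀ {X} (fs : ℕ → X → A) (inc : ∀ n → _≤̇_ P (fs n) (fs (suc n))) z b →
                 (∀ n → _⊑_ (lift P) (fmap (fs n) z) b) → _⊑_ (lift P) (fmap (⨆̇ P fs inc) z) b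
  fmap-⨆-least {X} fs inc = proj₂ (lc (discrete X) P fs (λ n → discrete-continuous P (fs n)) inc)

  fmap-mono : ∀ {X} {s t : X → A} → _≤̇_ P s t → ∀ z → _⊑_ (lift P) (fmap s z) (fmap t z)
  fmap-mono {X} {s} {t} s≤t z =
    subst (λ v → _⊑_ (lift P) (fmap s z) v) (fmap-cong ⨆≡t z) (fmap-⨆-upper chain increasing z 0)
    where
    chain : ℕ → X → A
    chain zero    = s
    chain (suc _) = t
    increasing : ∀ n → _≤̇_ P (chain n) (chain (suc n))
    increasing zero    = s≤t
    increasing (suc _) = λ _ → ⊑-refl P
    chain≤t : ∀ x n → _⊑_ P (chain n x) (t x)
    chain≤t x zero    = s≤t x
    chain≤t x (suc _) = ⊑-refl P
    ⨆≡t : ∀ x → ⨆̇ P chain increasing x ≡ t x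
    ⨆≡t x = ⊑-antisym P (⨆-least P _ _ _ (chain≤t x)) (⨆-ub P _ _ 1)

  fmap-⨆ : ∀ {X} (fs : ℕ → X → A) (inc : ∀ n → _≤̇_ P (fs n) (fs (suc n))) z →
           fmap (⨆̇ P fs inc) z ≡ ⨆ (lift P) (λ n → fmap (fs n) z) (λ n → fmap-mono (inc n) z)
  fmap-⨆ fs inc z = ⊑-antisym (lift P)
    (fmap-⨆-least fs inc z _ (⨆-ub (lift P) _ _))
    (⨆-least (lift P) _ _ _ (fmap-⨆-upper fs inc z))

  eval : ∀ {X} → (X → A) → F₀ X ⊎ A → A
  eval s = [ α , id ] ∘ (fmap s ⊎map id)

  eval-cong : ∀ {X} {s t : X → A} → (∀ x → s x ≡ t x) → ∀ u → eval s u ≡ eval t u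
  eval-cong s≡t (inj₁ z) = cong α (fmap-cong s≡t z)
  eval-cong s≡t (inj₂ _) = refl

  eval-fmap : ∀ {X Y} (s : Y → A) (h : X → Y) u → eval (s ∘ h) u ≡ eval s ((fmap h ⊎map id) u)
  eval-fmap s h (inj₁ z) = cong α (fmap-∘ s h z)
  eval-fmap s h (inj₂ _) = refl

  module _ (α-continuous : Continuous (lift P) P α) where
    open Continuous α-continuous

    eval-mono : ∀ {X} {s t : X → A} → _≤̇_ P s t → ∀ u → _⊑_ P (eval s u) (eval t u)
    eval-mono s≤t (inj₁ z) = mono (fmap-mono s≤t z)
    eval-mono s≤t (inj₂ _) = ⊑-refl P

    eval-⨆ : ∀ {X} (fs : ℕ → X → A) inc u →
             eval (⨆̇ P fs inc) u ≡ ⨆ P (λ n → eval (fs n) u) (λ n → eval-mono (inc n) u)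
    eval-⨆ fs inc (inj₁ z) = trans (cong α (fmap-⨆ fs inc z))
                                   (trans (pres _ _) (⨆-cong P _ _ _ _ (λ _ → refl)))
    eval-⨆ fs inc (inj₂ a) = sym (⨆-const P a _)

    module _ (⊥ : A) (⊥-least : ∀ a → _⊑_ P ⊥ a) where
      open Kleene P ⊥ ⊥-least

      equationOperator : ∀ {X} → (X → F₀ X ⊎ A) → ContinuousOperator X
      equationOperator e = record
        { apply = λ s x → eval s (e x)
        ; mono  = λ s≤t x → eval-mono s≤t (e x)
        ; pres  = λ fs inc x → eval-⨆ fs inc (e x) }

      _† : ∀ {X} → (X → F₀ X ⊎ A) → X → A
      e † = lfp (equationOperator e)

      †-solution : ∀ {X} (e : X → F₀ X ⊎ A) x → (e †) x ≡ eval (e †) (e x)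
      †-solution e = lfp-fixed (equationOperator e)

      †-least : ∀ {X} (e : X → F₀ X ⊎ A) (t : X → A) → (∀ x → eval t (e x) ≡ t x) →
                _≤̇_ P (e †) t
      †-least e t solves = lfp-least (equationOperator e) t (λ x → ⊑-reflexive P (solves x))

      †-functorial : ∀ {X Y} (e : X → F₀ X ⊎ A) (f : Y → F₀ Y ⊎ A) (h : X → Y) →
                     (∀ x → (fmap h ⊎map id) (e x) ≡ f (h x)) → ∀ x → (e †) x ≡ (f †) (h x)
      †-functorial e f h e≡f∘h = lfp-natural (equationOperator e) (equationOperator f) h
        λ s t s≡t∘h x → begin
          eval s (e x)                     ≡⟨ eval-cong s≡t∘h (e x) ⟩
          eval (t ∘ h) (e x)               ≡⟨ eval-fmap t h (e x) ⟩
          eval t ((fmap h ⊎map id) (e x))  ≡⟨ cong (eval t) (e≡f∘h x) ⟩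
          eval t (f (h x))                 ∎
        where open ≡-Reasoning

      module _ {X Y : Set} (e : X → F₀ X ⊎ Y) (f : Y → F₀ Y ⊎ A) where

        ⊕-inj₂ : ∀ y → (fmap inj₂ ⊎map id) (f y) ≡ ⊕ H f e (inj₂ y)
        ⊕-inj₂ y with f y
        ... | inj₁ _ = refl
        ... | inj₂ _ = refl

        eval-⊕-inj₁ : (s : X ⊎ Y → A) (k : Y → A) → (∀ y → eval (s ∘ inj₂) (f y) ≡ k y) →
                      ∀ x → eval s (⊕ H f e (inj₁ x)) ≡ eval (s ∘ inj₁) ((_•_ {H} k e) x)
        eval-⊕-inj₁ s k solves x with e x
        ... | inj₁ z = cong α (sym (fmap-∘ s inj₁ z))
        ... | inj₂ y = begin
          eval s (⊕ H f e (inj₂ y))          ≡⟨ cong (eval s) (sym (⊕-inj₂ y)) ⟩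
          eval s ((fmap inj₂ ⊎map id) (f y)) ≡⟨ sym (eval-fmap s inj₂ (f y)) ⟩
          eval (s ∘ inj₂) (f y)              ≡⟨ solves y ⟩
          k y                                ∎
          where open ≡-Reasoning

        †-compositional : ∀ x → ((_•_ {H} (f †) e) †) x ≡ (⊕ H f e †) (inj₁ x)
        †-compositional x = ⊑-antisym P
          (†-least f†•e (g † ∘ inj₁) g†∘inj₁-solves x)
          (†-least g [ f†•e † , f † ] copair-solves (inj₁ x))
          where
          f†•e : X → F₀ X ⊎ A
          f†•e = _•_ {H} (f †) e

          g : X ⊎ Y → F₀ (X ⊎ Y) ⊎ A
          g = ⊕ H f e

          g†∘inj₂≡f† : ∀ y → (g †) (inj₂ y) ≡ (f †) y
          g†∘inj₂≡f† y = sym (†-functorial f g inj₂ ⊕-inj₂ y)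

          g†∘inj₁-solves : ∀ x → eval (g † ∘ inj₁) (f†•e x) ≡ (g †) (inj₁ x)
          g†∘inj₁-solves x = sym (trans (†-solution g (inj₁ x))
            (eval-⊕-inj₁ (g †) (f †)
              (λ y → trans (eval-cong g†∘inj₂≡f† (f y)) (sym (†-solution f y))) x))

          copair-solves : ∀ w → eval [ f†•e † , f † ] (g w) ≡ [ f†•e † , f † ] w
          copair-solves (inj₁ x) = trans
            (eval-⊕-inj₁ _ (f †) (λ y → sym (†-solution f y)) x)
            (sym (†-solution f†•e x))
          copair-solves (inj₂ y) = begin
            eval [ _ , f † ] (g (inj₂ y))                ≡⟨ cong (eval _) (sym (⊕-inj₂ y)) ⟩
            eval [ _ , f † ] ((fmap inj₂ ⊎map id) (f y)) ≡⟨ sym (eval-fmap _ inj₂ (f y)) ⟩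
            eval (f †) (f y)                              ≡⟨ sym (†-solution f y) ⟩
            (f †) y                                       ∎
            where open ≡-Reasoning

      completeElgot : CompleteElgot H A α
      completeElgot = record
        { _†            = _†
        ; solution      = †-solution
        ; functorial    = †-functorial
        ; compositional = †-compositional
        }

corollary3p8 : (H : Functor) (L : Lifting H) → LocallyContinuous H L →
    (A : Set) (α : Functor.F₀ H A → A) → CPOEnrichable H L A α →
    CompleteElgot H A α
corollary3p8 H L lc A α (P , ⊥ , ⊥-least , α-continuous) =
  completeElgot H L lc α P α-continuous ⊥ ⊥-least
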